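{- Let $i\ge 2$, let $K_i$ be the complete graph on $[i]=\{1,\ldots,i\}$, and let $I\subseteq\mathbb{K}[x_e: e\in E(K_i)]$ be the cut ideal of $K_i$, with $r$ minimal monomial generators. Then the set of ideals $\{I_k : 1\le k\le r\}$ of the (usual) lcm-filtration of $I$ coincides with the set of ideals appearing in the stepwise lcm-filtration of $I$, i.e. with the set of nonzero ideals among $\underline{I}_1,\underline{I}_2,\ldots$.
   Context: $\mathbb{K}$ is a field. For a partition $C$ of $[i]$ into nonempty blocks, $E(C)$ is the set of edges $\{a,b\}$ of $K_i$ with endpoints in different blocks and $m_C=\prod_{e\in E(C)}x_e$. The cut ideal of $K_i$ is the ideal generated by all $m_C$ with $C$ a partition of $[i]$ into two nonempty blocks. For a monomial ideal $J$, $G(J)$ is its minimal monomial generating set. If $G(I)=\{m_1,\ldots,m_r\}$, the $k$-fold lcm-ideal $I_k$ is the ideal generated by $\operatorname{lcm}(\{m_t\}_{t\in\sigma})$ over all $\sigma\subseteq\{1,\ldots,r\}$ with $|\sigma|=k$; the usual lcm-filtration is $I=I_1\supseteq I_2\supseteq\cdots\supseteq I_r$. The stepwise lcm-filtration is defined by $\underline{I}_1=I$ and, for $k\ge 2$, $\underline{I}_k$ is the ideal generated by $\{\operatorname{lcm}(m,m') : m,m'\in G(\underline{I}_{k-1}),\ m\ne m'\}$. -}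

module Defs where

open import Data.Nat using (ℕ; zero; suc; _≤_; _<_; _⊔_)
open import Data.Fin using (Fin) renaming (zero to fzero; suc to fsuc; _<_ to _<ᶠ_)
open import Data.Fin.Subset using (Subset)
open import Data.Vec using (_∷_; [])
open import Data.Bool using (Bool; true; false; if_then_else_)
open import Data.Product using (Σ; ∃; _×_; _,_)
open import Relation.Binary.PropositionalEquality using (_≡_)
open import Relation.Nullary using (¬_)

Edge : ℕ → Set
Edge i = Σ (Fin i) λ a → Σ (Fin i) λ b → a <ᶠ b

Mon : ℕ → Set
Mon i = Edge i → ℕ

_∣ₘ_ : ∀ {i} → Mon i → Mon i → Set
m ∣ₘ m' = ∀ e → m e ≤ m' e

_≈ₘ_ : ∀ {i} → Mon i → Mon i → Set
m ≈ₘ m' = ∀ e → m e ≡ m' e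

lcmₘ : ∀ {i} → Mon i → Mon i → Mon i
lcmₘ m m' e = m e ⊔ m' e

lcmOver : ∀ {i r} → (Fin r → Mon i) → Subset r → Mon i
lcmOver {r = zero} m [] e = 0
lcmOver {r = suc r} m (b ∷ σ) e =
  (if b then m fzero e else 0) ⊔ lcmOver (λ t → m (fsuc t)) σ e

-- A monomial ideal, represented by the set of monomials it contains.
MonIdeal : ℕ → Set₁
MonIdeal i = Mon i → Set

⟨_⟩ : ∀ {i} → (Mon i → Set) → MonIdeal i
⟨ S ⟩ u = ∃ λ g → S g × (g ∣ₘ u)

_≐_ : ∀ {i} → MonIdeal i → MonIdeal i → Set
J ≐ J' = ∀ u → (J u → J' u) × (J' u → J u)

NonzeroIdeal : ∀ {i} → MonIdeal i → Set
NonzeroIdeal J = ∃ λ u → J u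

G : ∀ {i} → MonIdeal i → Mon i → Set
G J m = J m × (∀ m' → J m' → m' ∣ₘ m → m ∣ₘ m')

cutMon : ∀ {i} → (Fin i → Bool) → Mon i
cutMon c (a , b , _) with c a | c b
... | true  | true  = 0
... | false | false = 0
... | true  | false = 1
... | false | true  = 1

CutGen : ∀ {i} → Mon i → Set
CutGen {i} u = Σ (Fin i → Bool) λ c →
  (∃ λ a → c a ≡ true) × (∃ λ b → c b ≡ false) × (u ≈ₘ cutMon c)

CutIdeal : (i : ℕ) → MonIdeal i
CutIdeal i = ⟨ CutGen {i} ⟩

-- usual lcm-filtration I_k w.r.t. an enumeration m : Fin r → Mon i of G(I)
lcmIdeal : ∀ {i r} → (Fin r → Mon i) → ℕ → MonIdeal i
lcmIdeal {r = r} m k = ⟨ (λ u → Σ (Subset r) λ σ →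
  (Data.Fin.Subset.∣ σ ∣ ≡ k) × (u ≈ₘ lcmOver m σ)) ⟩

pairLcm : ∀ {i} → MonIdeal i → MonIdeal i
pairLcm J = ⟨ (λ u → ∃ λ m → ∃ λ m' →
  G J m × G J m' × ¬ (m ≈ₘ m') × (u ≈ₘ lcmₘ m m')) ⟩

-- stepwise lcm-filtration; only indices k ≥ 1 are meaningful
-- (stepwise J 0 is a dummy equal to J)
stepwise : ∀ {i} → MonIdeal i → ℕ → MonIdeal i
stepwise J zero = J
stepwise J (suc zero) = J
stepwise J (suc (suc k)) = pairLcm (stepwise J (suc k))

{-# OPTIONS --safe #-}
module Submission where

-- Let J_p be the ideal generated by the monomials m_C of the partitions C of [i] into exactly p
-- blocks, so that the cut ideal is J_2. The lcm of two distinct generators of J_p is divisible by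
-- the monomial of a (p+1)-block partition, obtained by splitting a block of the one along the other;
-- conversely, merging the blocks {0,1}, resp. {1,2}, of a (p+1)-block partition gives two distinct
-- p-block partitions whose monomials divide its own. Hence the stepwise filtration is J_2, J_3, … .
-- The lcm of a set of cuts is m_C for their common refinement C, and the cuts coarser than a
-- partition with n + 1 blocks correspond to the nonempty subsets of n of its blocks, so there are
-- 2^n − 1 of them. So k distinct cuts refine to at least q + 2 blocks when 2^q ≤ k, and every
-- (q+2)-block partition refines at least k cuts when k < 2^(q+1). Thus I_k = J_(q+2) for
-- 2^q ≤ k < 2^(q+1), and both filtrations run through the nonzero ideals among J_2, J_3, … .

open import Defs
open import Algebra.Bundles using (CommutativeRing)
open import Data.Bool using (Bool; true; false; not; _xor_; if_then_else_; _∧_)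
import Data.Bool.Properties as Boolₚ
open import Data.Bool.Properties using (xor-same; xor-identityʳ; xor-∧-commutativeRing)
open import Algebra.Properties.Group (CommutativeRing.+-group xor-∧-commutativeRing)
  using () renaming (∙-cancelʳ to xor-cancelʳ)
open import Data.Empty using (⊥-elim)
open import Data.Fin using (Fin; zero; suc; pinch) renaming (_<_ to _<ᶠ_)
open import Data.Fin.Properties
  using (2↔Bool; _≟_; <-cmp; ¬∀⟶∃¬; all?; any?; injective⇒≤; suc-injective; pinch-surjective)
open import Data.Fin.Subset using (Subset; _∈_; _⊆_; _∩_; ∣_∣; ⁅_⁆; ⊤; Empty) renaming (⊥ to ∅)
open import Data.Fin.Subset.Properties
  using ( _∈?_; nonempty?; Empty-unique; ∣⊥∣≡0; ∣⊤∣≡n; ∣p∣≤n; x∈⁅x⁆; x∈⁅y⁆⇒x≡y; ∣⁅x⁆∣≡1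
        ; p⊆q⇒∣p∣≤∣q∣; x∈p∩q⁺; x∈p∩q⁻; out⊆; in⊆in; ⊥⊆)
open import Data.Nat using (ℕ; zero; suc; _+_; _^_; _≤_; _<_; _≥_; z≤n; s≤s; _⊔_; _≤′_; ≤′-refl; ≤′-step)
open import Data.Nat.Properties
  using ( ≤-refl; ≤-reflexive; ≤-trans; ≤-antisym; ≤-<-trans; ≤-pred; ≰⇒>; <⇒≱; 1+n≰n; n<1+n; ≤⇒≤′; _≤?_
        ; m≤m⊔n; m≤n⊔m; ⊔-lub; +-comm; +-suc; +-identityʳ; +-mono-≤; +-mono-≤-<; ^-monoʳ-≤; ^-monoʳ-<; m^n>0
        ; module ≤-Reasoning)
open import Data.Product using (Σ; ∃; ∃₂; _×_; _,_; proj₁; proj₂; <_,_>; uncurry)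
open import Data.Vec using (Vec; []; _∷_; head; tail; tabulate; lookup; here; there)
open import Data.Vec.Properties
  using (lookup∘tabulate; tabulate∘lookup; tabulate-cong; lookup-replicate; []=⇒lookup; lookup⇒[]=; ∷-injectiveʳ)
open import Function using (_∘_)
open import Function.Bundles using (Inverse; _⇔_; mk⇔)
open import Function.Definitions using (StrictlySurjective)
open import Function.Consequences.Propositional using (surjective⇒strictlySurjective)
open import Level using (0ℓ)
open import Relation.Binary using (Rel; IsDecEquivalence; DecidableEquality; tri<; tri≈; tri>)
import Relation.Binary.Construct.On as On
open import Relation.Binary.PropositionalEquality
  using (_≡_; _≢_; refl; sym; trans; cong; cong₂; subst; subst₂; module ≡-Reasoning)
open import Relation.Nullary using (¬_; Dec; yes; no; does)
open import Relation.Nullary.Decidable using (_→-dec_; dec-true; does-⇔)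
open import Relation.Unary using (Pred; Decidable)

module _ {i : ℕ} where

  ∣ₘ-refl : {m : Mon i} → m ∣ₘ m
  ∣ₘ-refl e = ≤-refl

  ∣ₘ-trans : {m m' m'' : Mon i} → m ∣ₘ m' → m' ∣ₘ m'' → m ∣ₘ m''
  ∣ₘ-trans m∣m' m'∣m'' e = ≤-trans (m∣m' e) (m'∣m'' e)

  ∣ₘ-antisym : {m m' : Mon i} → m ∣ₘ m' → m' ∣ₘ m → m ≈ₘ m'
  ∣ₘ-antisym m∣m' m'∣m e = ≤-antisym (m∣m' e) (m'∣m e)

  ≈ₘ⇒∣ₘ : {m m' : Mon i} → m ≈ₘ m' → m ∣ₘ m'
  ≈ₘ⇒∣ₘ m≈m' e = ≤-reflexive (m≈m' e)

  ≈ₘ-sym : {m m' : Mon i} → m ≈ₘ m' → m' ≈ₘ m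
  ≈ₘ-sym m≈m' e = sym (m≈m' e)

  ≈ₘ-trans : {m m' m'' : Mon i} → m ≈ₘ m' → m' ≈ₘ m'' → m ≈ₘ m''
  ≈ₘ-trans m≈m' m'≈m'' e = trans (m≈m' e) (m'≈m'' e)

  lcmₘ-least : {m m' u : Mon i} → m ∣ₘ u → m' ∣ₘ u → lcmₘ m m' ∣ₘ u
  lcmₘ-least m∣u m'∣u e = ⊔-lub (m∣u e) (m'∣u e)

  ∣ₘ-lcmₘˡ : (m m' : Mon i) → m ∣ₘ lcmₘ m m'
  ∣ₘ-lcmₘˡ m m' e = m≤m⊔n (m e) (m' e)

  ∣ₘ-lcmₘʳ : (m m' : Mon i) → m' ∣ₘ lcmₘ m m'
  ∣ₘ-lcmₘʳ m m' e = m≤n⊔m (m e) (m' e)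

  ≐-sym : {A B : MonIdeal i} → A ≐ B → B ≐ A
  ≐-sym A≐B u = proj₂ (A≐B u) , proj₁ (A≐B u)

  ≐-trans : {A B C : MonIdeal i} → A ≐ B → B ≐ C → A ≐ C
  ≐-trans A≐B B≐C u = proj₁ (B≐C u) ∘ proj₁ (A≐B u) , proj₂ (A≐B u) ∘ proj₂ (B≐C u)

  ≐-nonzero : {A B : MonIdeal i} → A ≐ B → NonzeroIdeal A → NonzeroIdeal B
  ≐-nonzero A≐B (u , Au) = u , proj₁ (A≐B u) Au

  ⟨⟩-mono : {S S' : Mon i → Set} → (∀ {u} → S u → S' u) → ∀ {u} → ⟨ S ⟩ u → ⟨ S' ⟩ u
  ⟨⟩-mono S⊆S' (g , Sg , g∣u) = g , S⊆S' Sg , g∣u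

  ⟨⟩-upward : {S : Mon i → Set} {u v : Mon i} → ⟨ S ⟩ u → u ∣ₘ v → ⟨ S ⟩ v
  ⟨⟩-upward (g , Sg , g∣u) u∣v = g , Sg , ∣ₘ-trans g∣u u∣v

  G-cong : {A B : MonIdeal i} → A ≐ B → ∀ {u} → G A u → G B u
  G-cong A≐B {u} (Au , u-min) = proj₁ (A≐B u) Au , λ m' Bm' → u-min m' (proj₂ (A≐B m') Bm')

  pairLcm-cong : {A B : MonIdeal i} → A ≐ B → pairLcm A ≐ pairLcm B
  pairLcm-cong A≐B u = transport A≐B , transport (≐-sym A≐B)
    where
    transport : {A B : MonIdeal i} → A ≐ B → pairLcm A u → pairLcm B u
    transport A≐B (v , (m , m' , Gm , Gm' , m≉m' , v≈lcm) , v∣u) =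
      v , (m , m' , G-cong A≐B Gm , G-cong A≐B Gm' , m≉m' , v≈lcm) , v∣u

  module _ {S : Mon i → Set} (S-resp : ∀ {g u} → S g → g ≈ₘ u → S u) where

    G⟨⟩⇒ : ∀ {u} → G ⟨ S ⟩ u → S u
    G⟨⟩⇒ ((g , Sg , g∣u) , u-min) = S-resp Sg (∣ₘ-antisym g∣u (u-min g (g , Sg , ∣ₘ-refl) g∣u))

    G⟨⟩⇐ : (∀ {g g'} → S g → S g' → g ∣ₘ g' → g' ∣ₘ g) → ∀ {u} → S u → G ⟨ S ⟩ u
    G⟨⟩⇐ antichain {u} Su =
      (u , Su , ∣ₘ-refl) , λ m' (g , Sg , g∣m') m'∣u → ∣ₘ-trans (antichain Sg Su (∣ₘ-trans g∣m' m'∣u)) g∣m'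

-- Partitions and their monomials

Refines : ∀ {i} {A B : Set} → (Fin i → A) → (Fin i → B) → Set
Refines f g = ∀ x y → f x ≡ f y → g x ≡ g y

refines? : ∀ {i} {A B : Set} → DecidableEquality A → DecidableEquality B →
  (f : Fin i → A) (g : Fin i → B) → Dec (Refines f g)
refines? _≟A_ _≟B_ f g = all? λ x → all? λ y → (f x ≟A f y) →-dec (g x ≟B g y)

¬refines⇒separated : ∀ {i} {A B : Set} → DecidableEquality A → DecidableEquality B →
  {f : Fin i → A} {g : Fin i → B} → ¬ Refines f g → ∃₂ λ x y → f x ≡ f y × g x ≢ g y
¬refines⇒separated {i} _≟A_ _≟B_ {f} {g} f⋢g
  with x , f⋢g-at-x ← ¬∀⟶∃¬ i _ (λ x → all? λ y → (f x ≟A f y) →-dec (g x ≟B g y)) f⋢g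
  with y , f⋢g-at-xy ← ¬∀⟶∃¬ i _ (λ y → (f x ≟A f y) →-dec (g x ≟B g y)) f⋢g-at-x
  with f x ≟A f y
... | yes fx≡fy = x , y , fx≡fy , λ gx≡gy → f⋢g-at-xy λ _ → gx≡gy
... | no fx≢fy = ⊥-elim (f⋢g-at-xy λ fx≡fy → ⊥-elim (fx≢fy fx≡fy))

separation : ∀ {p} → Fin p → Fin p → ℕ
separation u v = if does (u ≟ v) then 0 else 1

separation-≡ : ∀ {p} {u v : Fin p} → u ≡ v → separation u v ≡ 0
separation-≡ {u = u} {v} u≡v = cong (if_then 0 else 1) (dec-true (u ≟ v) u≡v)

separation≤1 : ∀ {p} (u v : Fin p) → separation u v ≤ 1
separation≤1 u v with does (u ≟ v)
... | true = z≤n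
... | false = ≤-refl

separation≤0⇒≡ : ∀ {p} {u v : Fin p} → separation u v ≤ 0 → u ≡ v
separation≤0⇒≡ {u = u} {v} _ with u ≟ v
... | yes u≡v = u≡v
separation≤0⇒≡ () | no _

separation-comm : ∀ {p} (u v : Fin p) → separation u v ≡ separation v u
separation-comm u v with u ≟ v | v ≟ u
... | yes _ | yes _ = refl
... | no _ | no _ = refl
... | yes u≡v | no v≢u = ⊥-elim (v≢u (sym u≡v))
... | no u≢v | yes v≡u = ⊥-elim (u≢v (sym v≡u))

-- m_C for the partition C of [i] into the fibres of f.
partitionMon : ∀ {i p} → (Fin i → Fin p) → Mon i
partitionMon f (a , b , _) = separation (f a) (f b)

edgeBetween : ∀ {i} {x y : Fin i} → x ≢ y → Edge i
edgeBetween {x = x} {y} x≢y with <-cmp x y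
... | tri< x<y _ _ = x , y , x<y
... | tri≈ _ x≡y _ = ⊥-elim (x≢y x≡y)
... | tri> _ _ y<x = y , x , y<x

partitionMon-edgeBetween : ∀ {i p} (f : Fin i → Fin p) {x y : Fin i} (x≢y : x ≢ y) →
  partitionMon f (edgeBetween x≢y) ≡ separation (f x) (f y)
partitionMon-edgeBetween f {x} {y} x≢y with <-cmp x y
... | tri< _ _ _ = refl
... | tri≈ _ x≡y _ = ⊥-elim (x≢y x≡y)
... | tri> _ _ _ = separation-comm (f y) (f x)

refines⇒partitionMon-∣ : ∀ {i p p'} {f : Fin i → Fin p} {g : Fin i → Fin p'} →
  Refines f g → partitionMon g ∣ₘ partitionMon f
refines⇒partitionMon-∣ {f = f} {g} f⊑g (a , b , _) with f a ≟ f b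
... | yes fa≡fb = ≤-trans (≤-reflexive (separation-≡ (f⊑g a b fa≡fb))) z≤n
... | no _ = separation≤1 (g a) (g b)

partitionMon-∣⇒refines : ∀ {i p p'} {f : Fin i → Fin p} {g : Fin i → Fin p'} →
  partitionMon g ∣ₘ partitionMon f → Refines f g
partitionMon-∣⇒refines {f = f} {g} g∣f x y fx≡fy with x ≟ y
... | yes refl = refl
... | no x≢y = separation≤0⇒≡ (begin
  separation (g x) (g y)             ≡⟨ partitionMon-edgeBetween g x≢y ⟨
  partitionMon g (edgeBetween x≢y)   ≤⟨ g∣f (edgeBetween x≢y) ⟩
  partitionMon f (edgeBetween x≢y)   ≡⟨ partitionMon-edgeBetween f x≢y ⟩
  separation (f x) (f y)             ≡⟨ separation-≡ fx≡fy ⟩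
  0                                  ∎)
  where open ≤-Reasoning

partitionMon-∣-lcmₘ : ∀ {i p p' p''} {f : Fin i → Fin p} {g : Fin i → Fin p'} {h : Fin i → Fin p''} →
  Refines < f , g > h → partitionMon h ∣ₘ lcmₘ (partitionMon f) (partitionMon g)
partitionMon-∣-lcmₘ {f = f} {g} {h} fg⊑h (a , b , _) with f a ≟ f b
... | no _ = ≤-trans (separation≤1 (h a) (h b)) (m≤m⊔n 1 (separation (g a) (g b)))
... | yes fa≡fb with g a ≟ g b
...   | no _ = ≤-trans (separation≤1 (h a) (h b)) (m≤n⊔m 0 1)
...   | yes ga≡gb = ≤-trans (≤-reflexive (separation-≡ (fg⊑h a b (cong₂ _,_ fa≡fb ga≡gb)))) z≤n

-- Counting blocks

∘-strictlySurjective : ∀ {A B C : Set} {f : A → B} {g : B → C} →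
  StrictlySurjective _≡_ f → StrictlySurjective _≡_ g → StrictlySurjective _≡_ (g ∘ f)
∘-strictlySurjective {f = f} f-onto g-onto c with b , gb≡c ← g-onto c with a , fa≡b ← f-onto b =
  a , trans (cong _ fa≡b) gb≡c

strictlySurjective⇒≥ : ∀ {m n} {f : Fin m → Fin n} → StrictlySurjective _≡_ f → m ≥ n
strictlySurjective⇒≥ {f = f} f-onto = injective⇒≤ section-injective
  where
  section-injective : ∀ {j j'} → proj₁ (f-onto j) ≡ proj₁ (f-onto j') → j ≡ j'
  section-injective {j} {j'} eq = trans (sym (proj₂ (f-onto j))) (trans (cong f eq) (proj₂ (f-onto j')))

refines⇒≥ : ∀ {i p p'} {f : Fin i → Fin p} {g : Fin i → Fin p'} →
  StrictlySurjective _≡_ f → StrictlySurjective _≡_ g → Refines f g → p ≥ p'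
refines⇒≥ {i} {p} {f = f} {g} f-onto g-onto f⊑g = strictlySurjective⇒≥ g∘section-onto
  where
  section : Fin p → Fin i
  section j = proj₁ (f-onto j)
  g∘section-onto : StrictlySurjective _≡_ (g ∘ section)
  g∘section-onto k with x , gx≡k ← g-onto k = f x , trans (f⊑g _ x (proj₂ (f-onto (f x)))) gx≡k

-- The block of a is split into the points where g agrees with g b, which form the new block zero,
-- and the rest.
split-block : ∀ {i p p'} {f : Fin i → Fin p} (g : Fin i → Fin p') → StrictlySurjective _≡_ f →
  ∀ {a b} → f a ≡ f b → g a ≢ g b →
  Σ (Fin i → Fin (suc p)) λ h → StrictlySurjective _≡_ h × Refines < f , g > h
split-block {i} {p} {p'} {f} g f-onto {a} {b} fa≡fb ga≢gb = h , h-onto , λ _ _ → cong (uncurry relabel)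
  where
  relabel : Fin p → Fin p' → Fin (suc p)
  relabel u v = if does (u ≟ f a) ∧ does (v ≟ g b) then zero else suc u
  h : Fin i → Fin (suc p)
  h x = relabel (f x) (g x)
  h-b : h b ≡ zero
  h-b with f b ≟ f a | g b ≟ g b
  ... | yes _ | yes _ = refl
  ... | no fb≢fa | _ = ⊥-elim (fb≢fa (sym fa≡fb))
  ... | yes _ | no gb≢gb = ⊥-elim (gb≢gb refl)
  h-off : ∀ x → ¬ (f x ≡ f a × g x ≡ g b) → h x ≡ suc (f x)
  h-off x off with f x ≟ f a | g x ≟ g b
  ... | yes fx≡fa | yes gx≡gb = ⊥-elim (off (fx≡fa , gx≡gb))
  ... | yes _ | no _ = refl
  ... | no _ | _ = refl
  h-onto : StrictlySurjective _≡_ h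
  h-onto zero = b , h-b
  h-onto (suc j) with x , fx≡j ← f-onto j with f x ≟ f a
  ... | yes fx≡fa = a , trans (h-off a λ (_ , ga≡gb) → ga≢gb ga≡gb) (cong suc (trans (sym fx≡fa) fx≡j))
  ... | no fx≢fa = x , trans (h-off x λ (fx≡fa , _) → fx≢fa fx≡fa) (cong suc fx≡j)

refines-sym-same-size : ∀ {i p} {f g : Fin i → Fin p} →
  StrictlySurjective _≡_ f → StrictlySurjective _≡_ g → Refines f g → Refines g f
refines-sym-same-size {f = f} {g} f-onto g-onto f⊑g x y gx≡gy with f x ≟ f y
... | yes fx≡fy = fx≡fy
... | no fx≢fy with h , h-onto , gf⊑h ← split-block f g-onto gx≡gy fx≢fy =
  ⊥-elim (1+n≰n (refines⇒≥ f-onto h-onto λ x' y' e → gf⊑h x' y' (cong₂ _,_ (f⊑g x' y' e) e)))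

coarsen : ∀ {i n p} → p ≤ n → {κ : Fin i → Fin (suc n)} → StrictlySurjective _≡_ κ →
  Σ (Fin i → Fin (suc p)) λ h → StrictlySurjective _≡_ h × Refines κ h
coarsen p≤n = go (≤⇒≤′ p≤n)
  where
  go : ∀ {i n p} → p ≤′ n → {κ : Fin i → Fin (suc n)} → StrictlySurjective _≡_ κ →
    Σ (Fin i → Fin (suc p)) λ h → StrictlySurjective _≡_ h × Refines κ h
  go ≤′-refl {κ} κ-onto = κ , κ-onto , λ _ _ eq → eq
  go (≤′-step p≤′n) κ-onto
    with h , h-onto , merged⊑h ← go p≤′n (∘-strictlySurjective κ-onto (surjective⇒strictlySurjective (pinch-surjective zero)))
    = h , h-onto , λ x y eq → merged⊑h x y (cong (pinch zero) eq)

kernel-surjection : ∀ {n ℓ} {_∼_ : Rel (Fin n) ℓ} → IsDecEquivalence _∼_ →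
  ∃ λ P → Σ (Fin n → Fin P) λ κ → StrictlySurjective _≡_ κ ×
    (∀ x y → x ∼ y → κ x ≡ κ y) × (∀ x y → κ x ≡ κ y → x ∼ y)
kernel-surjection {zero} _ = 0 , (λ ()) , (λ ()) , (λ ()) , (λ ())
kernel-surjection {suc n} {_∼_ = _∼_} ∼-isDecEquivalence
  with P , κ , κ-onto , ∼⇒≡ , ≡⇒∼ ← kernel-surjection (On.isDecEquivalence suc ∼-isDecEquivalence)
  with any? (λ x → IsDecEquivalence._≟_ ∼-isDecEquivalence zero (suc x))
... | yes (x₀ , 0∼x₀) = P , κ′ , κ′-onto , respects , reflects
  where
  module ∼ = IsDecEquivalence ∼-isDecEquivalence
  κ′ : Fin (suc n) → Fin P
  κ′ zero = κ x₀
  κ′ (suc x) = κ x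
  κ′-onto : StrictlySurjective _≡_ κ′
  κ′-onto j with x , κx≡j ← κ-onto j = suc x , κx≡j
  respects : ∀ x y → x ∼ y → κ′ x ≡ κ′ y
  respects zero zero _ = refl
  respects zero (suc y) 0∼y = ∼⇒≡ x₀ y (∼.trans (∼.sym 0∼x₀) 0∼y)
  respects (suc x) zero x∼0 = ∼⇒≡ x x₀ (∼.trans x∼0 0∼x₀)
  respects (suc x) (suc y) = ∼⇒≡ x y
  reflects : ∀ x y → κ′ x ≡ κ′ y → x ∼ y
  reflects zero zero _ = ∼.refl
  reflects zero (suc y) eq = ∼.trans 0∼x₀ (≡⇒∼ x₀ y eq)
  reflects (suc x) zero eq = ∼.trans (≡⇒∼ x x₀ eq) (∼.sym 0∼x₀)
  reflects (suc x) (suc y) = ≡⇒∼ x y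
... | no 0≁ = suc P , κ′ , κ′-onto , respects , reflects
  where
  module ∼ = IsDecEquivalence ∼-isDecEquivalence
  κ′ : Fin (suc n) → Fin (suc P)
  κ′ zero = zero
  κ′ (suc x) = suc (κ x)
  κ′-onto : StrictlySurjective _≡_ κ′
  κ′-onto zero = zero , refl
  κ′-onto (suc j) with x , κx≡j ← κ-onto j = suc x , cong suc κx≡j
  respects : ∀ x y → x ∼ y → κ′ x ≡ κ′ y
  respects zero zero _ = refl
  respects zero (suc y) 0∼y = ⊥-elim (0≁ (y , 0∼y))
  respects (suc x) zero x∼0 = ⊥-elim (0≁ (x , ∼.sym x∼0))
  respects (suc x) (suc y) x∼y = cong suc (∼⇒≡ x y x∼y)
  reflects : ∀ x y → κ′ x ≡ κ′ y → x ∼ y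
  reflects zero zero _ = ∼.refl
  reflects (suc x) (suc y) eq = ≡⇒∼ x y (suc-injective eq)

-- The ideals J_p and the stepwise filtration

PartitionGen : (i p : ℕ) → Mon i → Set
PartitionGen i p u = Σ (Fin i → Fin p) λ f → StrictlySurjective _≡_ f × (u ≈ₘ partitionMon f)

PartitionIdeal : (i p : ℕ) → MonIdeal i
PartitionIdeal i p = ⟨ PartitionGen i p ⟩

partitionGen-resp : ∀ {i p g u} → PartitionGen i p g → g ≈ₘ u → PartitionGen i p u
partitionGen-resp (f , f-onto , g≈f) g≈u = f , f-onto , ≈ₘ-trans (≈ₘ-sym g≈u) g≈f

partitionGen-antichain : ∀ {i p g g'} → PartitionGen i p g → PartitionGen i p g' → g ∣ₘ g' → g' ∣ₘ g
partitionGen-antichain (f , f-onto , g≈f) (f' , f'-onto , g'≈f') g∣g' =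
  ∣ₘ-trans (≈ₘ⇒∣ₘ g'≈f') (∣ₘ-trans (refines⇒partitionMon-∣ f⊑f') (≈ₘ⇒∣ₘ (≈ₘ-sym g≈f)))
  where
  f'⊑f : Refines f' f
  f'⊑f = partitionMon-∣⇒refines (∣ₘ-trans (≈ₘ⇒∣ₘ (≈ₘ-sym g≈f)) (∣ₘ-trans g∣g' (≈ₘ⇒∣ₘ g'≈f')))
  f⊑f' : Refines f f'
  f⊑f' = refines-sym-same-size f'-onto f-onto f'⊑f

G-PartitionIdeal⁻ : ∀ {i p u} → G (PartitionIdeal i p) u → PartitionGen i p u
G-PartitionIdeal⁻ = G⟨⟩⇒ partitionGen-resp

G-PartitionIdeal⁺ : ∀ {i p u} → PartitionGen i p u → G (PartitionIdeal i p) u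
G-PartitionIdeal⁺ = G⟨⟩⇐ partitionGen-resp partitionGen-antichain

G-partitionMon : ∀ {i p} {f : Fin i → Fin p} → StrictlySurjective _≡_ f → G (PartitionIdeal i p) (partitionMon f)
G-partitionMon f-onto = G-PartitionIdeal⁺ (_ , f-onto , λ _ → refl)

pairLcm-PartitionIdeal⊆ : ∀ {i p} u → pairLcm (PartitionIdeal i p) u → PartitionIdeal i (suc p) u
pairLcm-PartitionIdeal⊆ {i} u (v , (m , m' , Gm , Gm' , m≉m' , v≈lcm) , v∣u)
  with f , f-onto , m≈f ← G-PartitionIdeal⁻ Gm
  with f' , f'-onto , m'≈f' ← G-PartitionIdeal⁻ Gm'
  with refines? _≟_ _≟_ f f'
... | yes f⊑f' = ⊥-elim (m≉m' (≈ₘ-trans m≈f (≈ₘ-trans f≈f' (≈ₘ-sym m'≈f'))))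
  where
  f≈f' : partitionMon f ≈ₘ partitionMon f'
  f≈f' = ∣ₘ-antisym (refines⇒partitionMon-∣ (refines-sym-same-size f-onto f'-onto f⊑f'))
                    (refines⇒partitionMon-∣ f⊑f')
... | no f⋢f'
  with a , b , fa≡fb , f'a≢f'b ← ¬refines⇒separated _≟_ _≟_ f⋢f'
  with h , h-onto , ff'⊑h ← split-block f' f-onto fa≡fb f'a≢f'b
  = partitionMon h , (h , h-onto , λ _ → refl) ,
    ∣ₘ-trans (partitionMon-∣-lcmₘ ff'⊑h)
             (lcmₘ-least (divides-u {g = f} m≈f (∣ₘ-lcmₘˡ m m')) (divides-u {g = f'} m'≈f' (∣ₘ-lcmₘʳ m m')))
  where
  divides-u : ∀ {n} {g : Fin i → Fin n} {w} → w ≈ₘ partitionMon g → w ∣ₘ lcmₘ m m' → partitionMon g ∣ₘ u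
  divides-u w≈g w∣lcm = ∣ₘ-trans (≈ₘ⇒∣ₘ (≈ₘ-sym w≈g)) (∣ₘ-trans w∣lcm (∣ₘ-trans (≈ₘ⇒∣ₘ (≈ₘ-sym v≈lcm)) v∣u))

-- pinch zero and pinch (suc zero) merge the blocks {0,1}, resp. {1,2}, of h.
PartitionIdeal⊆pairLcm : ∀ {i p} u → PartitionIdeal i (3 + p) u → pairLcm (PartitionIdeal i (2 + p)) u
PartitionIdeal⊆pairLcm {i} {p} u (v , (h , h-onto , v≈h) , v∣u) =
  lcmₘ (partitionMon f) (partitionMon f') ,
  (partitionMon f , partitionMon f' , G-partitionMon f-onto , G-partitionMon f'-onto , f≉f' , λ _ → refl) ,
  lcmₘ-least (below-u {g = f} λ _ _ → cong (pinch zero)) (below-u {g = f'} λ _ _ → cong (pinch (suc zero)))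
  where
  pinch-onto : ∀ j → StrictlySurjective _≡_ (pinch j ∘ h)
  pinch-onto j = ∘-strictlySurjective h-onto (surjective⇒strictlySurjective (pinch-surjective j))
  f f' : Fin i → Fin (2 + p)
  f = pinch zero ∘ h
  f' = pinch (suc zero) ∘ h
  f-onto : StrictlySurjective _≡_ f
  f-onto = pinch-onto zero
  f'-onto : StrictlySurjective _≡_ f'
  f'-onto = pinch-onto (suc zero)
  below-u : ∀ {n} {g : Fin i → Fin n} → Refines h g → partitionMon g ∣ₘ u
  below-u h⊑g = ∣ₘ-trans (refines⇒partitionMon-∣ h⊑g) (∣ₘ-trans (≈ₘ⇒∣ₘ (≈ₘ-sym v≈h)) v∣u)
  f≉f' : ¬ (partitionMon f ≈ₘ partitionMon f')
  f≉f' f≈f' with x₀ , hx₀≡0 ← h-onto zero with x₁ , hx₁≡1 ← h-onto (suc zero)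
    with () ← trans (sym (cong (pinch (suc zero)) hx₀≡0))
                (trans (partitionMon-∣⇒refines (≈ₘ⇒∣ₘ (≈ₘ-sym f≈f')) x₀ x₁
                          (trans (cong (pinch zero) hx₀≡0) (sym (cong (pinch zero) hx₁≡1))))
                       (cong (pinch (suc zero)) hx₁≡1))

pairLcm-PartitionIdeal : ∀ {i} p → pairLcm (PartitionIdeal i (2 + p)) ≐ PartitionIdeal i (3 + p)
pairLcm-PartitionIdeal p u = pairLcm-PartitionIdeal⊆ u , PartitionIdeal⊆pairLcm u

bipartition : ∀ {i} → (Fin i → Bool) → Fin i → Fin 2
bipartition c = Inverse.from 2↔Bool ∘ c

bipartition-injective : ∀ {u v : Bool} → Inverse.from 2↔Bool u ≡ Inverse.from 2↔Bool v → u ≡ v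
bipartition-injective {u} {v} eq = trans (sym (Inverse.strictlyInverseˡ 2↔Bool u))
  (trans (cong (Inverse.to 2↔Bool) eq) (Inverse.strictlyInverseˡ 2↔Bool v))

cutMon≈partitionMon : ∀ {i} (c : Fin i → Bool) → cutMon c ≈ₘ partitionMon (bipartition c)
cutMon≈partitionMon c (a , b , _) with c a | c b
... | true  | true  = refl
... | true  | false = refl
... | false | true  = refl
... | false | false = refl

partitionMon≈cutMon : ∀ {i} (f : Fin i → Fin 2) → partitionMon f ≈ₘ cutMon (Inverse.to 2↔Bool ∘ f)
partitionMon≈cutMon f (a , b , _) with f a | f b
... | zero     | zero     = refl
... | zero     | suc zero = refl
... | suc zero | zero     = refl
... | suc zero | suc zero = refl

cutGen⇒partitionGen : ∀ {i u} → CutGen {i} u → PartitionGen i 2 u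
cutGen⇒partitionGen (c , (a , ca≡true) , (b , cb≡false) , u≈c) =
  bipartition c , onto , ≈ₘ-trans u≈c (cutMon≈partitionMon c)
  where
  onto : StrictlySurjective _≡_ (bipartition c)
  onto zero = b , cong (Inverse.from 2↔Bool) cb≡false
  onto (suc zero) = a , cong (Inverse.from 2↔Bool) ca≡true

partitionGen⇒cutGen : ∀ {i u} → PartitionGen i 2 u → CutGen {i} u
partitionGen⇒cutGen (f , f-onto , u≈f) =
  Inverse.to 2↔Bool ∘ f , side (suc zero) , side zero , ≈ₘ-trans u≈f (partitionMon≈cutMon f)
  where
  side : ∀ j → ∃ λ x → Inverse.to 2↔Bool (f x) ≡ Inverse.to 2↔Bool j
  side j = proj₁ (f-onto j) , cong (Inverse.to 2↔Bool) (proj₂ (f-onto j))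

cutGen-resp : ∀ {i g u} → CutGen {i} g → g ≈ₘ u → CutGen u
cutGen-resp (c , c-true , c-false , g≈c) g≈u = c , c-true , c-false , ≈ₘ-trans (≈ₘ-sym g≈u) g≈c

G-CutIdeal⁻ : ∀ {i u} → G (CutIdeal i) u → CutGen u
G-CutIdeal⁻ = G⟨⟩⇒ cutGen-resp

G-CutIdeal⁺ : ∀ {i u} → CutGen u → G (CutIdeal i) u
G-CutIdeal⁺ = G⟨⟩⇐ cutGen-resp λ Cg Cg' → partitionGen-antichain (cutGen⇒partitionGen Cg) (cutGen⇒partitionGen Cg')

CutIdeal≐PartitionIdeal₂ : ∀ {i} → CutIdeal i ≐ PartitionIdeal i 2
CutIdeal≐PartitionIdeal₂ u = ⟨⟩-mono cutGen⇒partitionGen , ⟨⟩-mono partitionGen⇒cutGen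

stepwise-CutIdeal : ∀ {i} l → stepwise (CutIdeal i) (suc l) ≐ PartitionIdeal i (2 + l)
stepwise-CutIdeal zero = CutIdeal≐PartitionIdeal₂
stepwise-CutIdeal (suc l) = ≐-trans (pairLcm-cong (stepwise-CutIdeal l)) (pairLcm-PartitionIdeal l)

-- Cuts coarser than a partition

refines⇒cutMon∣partitionMon : ∀ {i p} {f : Fin i → Fin p} {c : Fin i → Bool} →
  Refines f c → cutMon c ∣ₘ partitionMon f
refines⇒cutMon∣partitionMon {c = c} f⊑c = ∣ₘ-trans (≈ₘ⇒∣ₘ (cutMon≈partitionMon c))
  (refines⇒partitionMon-∣ λ x y → cong (Inverse.from 2↔Bool) ∘ f⊑c x y)

refines⇒cutMon∣cutMon : ∀ {i} {c c' : Fin i → Bool} → Refines c c' → cutMon c' ∣ₘ cutMon c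
refines⇒cutMon∣cutMon {c = c} c⊑c' = ∣ₘ-trans (refines⇒cutMon∣partitionMon λ x y → c⊑c' x y ∘ bipartition-injective)
  (≈ₘ⇒∣ₘ (≈ₘ-sym (cutMon≈partitionMon c)))

cutMon∣cutMon⇒refines : ∀ {i} {c c' : Fin i → Bool} → cutMon c' ∣ₘ cutMon c → Refines c c'
cutMon∣cutMon⇒refines {c = c} {c'} c'∣c x y cx≡cy = bipartition-injective (partitionMon-∣⇒refines
  (∣ₘ-trans (≈ₘ⇒∣ₘ (≈ₘ-sym (cutMon≈partitionMon c'))) (∣ₘ-trans c'∣c (≈ₘ⇒∣ₘ (cutMon≈partitionMon c))))
  x y (cong (Inverse.from 2↔Bool) cx≡cy))

SameCut : ∀ {i} → (Fin i → Bool) → (Fin i → Bool) → Set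
SameCut c c' = Refines c c' × Refines c' c

cutMon-≈⇒SameCut : ∀ {i} {c c' : Fin i → Bool} → cutMon c ≈ₘ cutMon c' → SameCut c c'
cutMon-≈⇒SameCut c≈c' = cutMon∣cutMon⇒refines (≈ₘ⇒∣ₘ (≈ₘ-sym c≈c')) , cutMon∣cutMon⇒refines (≈ₘ⇒∣ₘ c≈c')

SameCut⇒cutMon-≈ : ∀ {i} {c c' : Fin i → Bool} → SameCut c c' → cutMon c ≈ₘ cutMon c'
SameCut⇒cutMon-≈ (c⊑c' , c'⊑c) = ∣ₘ-antisym (refines⇒cutMon∣cutMon c'⊑c) (refines⇒cutMon∣cutMon c⊑c')

cutMon-≢ : ∀ {i} (c : Fin i → Bool) {a b} (a<b : a <ᶠ b) → c a ≢ c b → cutMon c (a , b , a<b) ≡ 1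
cutMon-≢ c {a} {b} _ ca≢cb with c a | c b
... | true  | true  = ⊥-elim (ca≢cb refl)
... | true  | false = refl
... | false | true  = refl
... | false | false = ⊥-elim (ca≢cb refl)

xor≡not-does : ∀ x y → x xor y ≡ not (does (x Boolₚ.≟ y))
xor≡not-does true  true  = refl
xor≡not-does true  false = refl
xor≡not-does false true  = refl
xor≡not-does false false = refl

xor-cong-⇔ : ∀ {x y x' y'} → (x ≡ y ⇔ x' ≡ y') → x xor y ≡ x' xor y'
xor-cong-⇔ {x} {y} {x'} {y'} iff = begin
  x xor y                     ≡⟨ xor≡not-does x y ⟩
  not (does (x Boolₚ.≟ y))    ≡⟨ cong not (does-⇔ iff (x Boolₚ.≟ y) (x' Boolₚ.≟ y')) ⟩
  not (does (x' Boolₚ.≟ y'))  ≡⟨ xor≡not-does x' y' ⟨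
  x' xor y'                   ∎
  where open ≡-Reasoning

module Crossing {i n} {κ : Fin i → Fin (suc n)} (κ-onto : StrictlySurjective _≡_ κ) where

  rep : Fin (suc n) → Fin i
  rep j = proj₁ (κ-onto j)

  κ-rep : ∀ j → κ (rep j) ≡ j
  κ-rep j = proj₂ (κ-onto j)

  -- A cut coarser than κ is recorded by the blocks 1, …, n of κ that lie on the other side from
  -- block 0; this identifies such cuts with the nonempty subsets of Fin n.
  crossing : (Fin i → Bool) → Subset n
  crossing c = tabulate λ j → c (rep (suc j)) xor c (rep zero)

  offset-crossing : ∀ {c} → Refines κ c → ∀ x → c x xor c (rep zero) ≡ lookup (false ∷ crossing c) (κ x)
  offset-crossing {c} κ⊑c x =
    trans (cong (_xor c (rep zero)) (κ⊑c x (rep (κ x)) (sym (κ-rep (κ x))))) (offset-rep (κ x))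
    where
    offset-rep : ∀ j → c (rep j) xor c (rep zero) ≡ lookup (false ∷ crossing c) j
    offset-rep zero = xor-same (c (rep zero))
    offset-rep (suc j) = sym (lookup∘tabulate _ j)

  crossing-injective : ∀ {c c'} → Refines κ c → Refines κ c' → crossing c ≡ crossing c' → Refines c c'
  crossing-injective {c} {c'} κ⊑c κ⊑c' eq x y cx≡cy = xor-cancelʳ (c' (rep zero)) (c' x) (c' y) (begin
    c' x xor c' (rep zero)  ≡⟨ offsets-agree x ⟨
    c x xor c (rep zero)    ≡⟨ cong (_xor c (rep zero)) cx≡cy ⟩
    c y xor c (rep zero)    ≡⟨ offsets-agree y ⟩
    c' y xor c' (rep zero)  ∎)
    where
    open ≡-Reasoning
    offsets-agree : ∀ x → c x xor c (rep zero) ≡ c' x xor c' (rep zero)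
    offsets-agree x = trans (offset-crossing κ⊑c x)
      (trans (cong (λ w → lookup (false ∷ w) (κ x)) eq) (sym (offset-crossing κ⊑c' x)))

  SameCut⇒crossing-≡ : ∀ {c c'} → SameCut c c' → crossing c ≡ crossing c'
  SameCut⇒crossing-≡ (c⊑c' , c'⊑c) = tabulate-cong λ j → xor-cong-⇔ (mk⇔ (c⊑c' _ _) (c'⊑c _ _))

  crossing-≢∅ : ∀ {c} → Refines κ c → (∃ λ a → c a ≡ true) → (∃ λ b → c b ≡ false) → crossing c ≢ ∅
  crossing-≢∅ {c} κ⊑c (a , ca≡true) (b , cb≡false) crossing≡∅ =
    true≢false (trans (sym ca≡true) (trans (on-base-side a) (trans (sym (on-base-side b)) cb≡false)))
    where
    true≢false : true ≢ false
    true≢false ()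
    on-base-side : ∀ x → c x ≡ c (rep zero)
    on-base-side x = xor-cancelʳ (c (rep zero)) (c x) (c (rep zero)) (begin
      c x xor c (rep zero)              ≡⟨ offset-crossing κ⊑c x ⟩
      lookup (false ∷ crossing c) (κ x)  ≡⟨ cong (λ w → lookup (false ∷ w) (κ x)) crossing≡∅ ⟩
      lookup (false ∷ ∅) (κ x)           ≡⟨ lookup-replicate (κ x) false ⟩
      false                             ≡⟨ xor-same (c (rep zero)) ⟨
      c (rep zero) xor c (rep zero)     ∎)
      where open ≡-Reasoning

  cutThrough : Subset n → Fin i → Bool
  cutThrough w x = lookup (false ∷ w) (κ x)

  κ⊑cutThrough : ∀ w → Refines κ (cutThrough w)
  κ⊑cutThrough w _ _ = cong (lookup (false ∷ w))

  crossing-cutThrough : ∀ w → crossing (cutThrough w) ≡ w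
  crossing-cutThrough w = trans (tabulate-cong entry) (tabulate∘lookup w)
    where
    entry : ∀ j → cutThrough w (rep (suc j)) xor cutThrough w (rep zero) ≡ lookup w j
    entry j = trans (cong₂ _xor_ (cong (lookup (false ∷ w)) (κ-rep (suc j))) (cong (lookup (false ∷ w)) (κ-rep zero)))
                    (xor-identityʳ (lookup w j))

  cutThrough-false : ∀ w → ∃ λ b → cutThrough w b ≡ false
  cutThrough-false w = rep zero , cong (lookup (false ∷ w)) (κ-rep zero)

  cutThrough-true : ∀ {w} → w ≢ ∅ → ∃ λ a → cutThrough w a ≡ true
  cutThrough-true {w} w≢∅ with nonempty? w
  ... | yes (j , j∈w) = rep (suc j) , trans (cong (lookup (false ∷ w)) (κ-rep (suc j))) ([]=⇒lookup j∈w)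
  ... | no empty = ⊥-elim (w≢∅ (Empty-unique empty))

-- Counting subsets of Fin r through binary words

2^suc : ∀ n → 2 ^ suc n ≡ 2 ^ n + 2 ^ n
2^suc n = cong (2 ^ n +_) (+-identityʳ (2 ^ n))

2^q<2^n⇒q<n : ∀ {q n} → 2 ^ q < 2 ^ n → q < n
2^q<2^n⇒q<n lt = ≰⇒> λ n≤q → <⇒≱ lt (^-monoʳ-≤ 2 n≤q)

n<2^n : ∀ n → n < 2 ^ n
n<2^n zero = s≤s z≤n
n<2^n (suc n) = subst₂ _≤_ (+-comm (suc n) 1) (sym (2^suc n)) (+-mono-≤ (n<2^n n) (m^n>0 2 n))

log₂-bracket : ∀ {k} → 1 ≤ k → ∃ λ q → 2 ^ q ≤ k × k < 2 ^ suc q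
log₂-bracket {k} 1≤k = search k (n<2^n k)
  where
  search : ∀ n → k < 2 ^ n → ∃ λ q → 2 ^ q ≤ k × k < 2 ^ suc q
  search zero k<1 = ⊥-elim (<⇒≱ k<1 1≤k)
  search (suc n) k<2^n+1 with 2 ^ n ≤? k
  ... | yes 2^n≤k = n , 2^n≤k , k<2^n+1
  ... | no 2^n≰k = search n (≰⇒> 2^n≰k)

Empty⇒∣p∣≡0 : ∀ {r} {p : Subset r} → Empty p → ∣ p ∣ ≡ 0
Empty⇒∣p∣≡0 {r} empty = trans (cong ∣_∣ (Empty-unique empty)) (∣⊥∣≡0 r)

x∈p⇒1≤∣p∣ : ∀ {r} {p : Subset r} {x} → x ∈ p → 1 ≤ ∣ p ∣
x∈p⇒1≤∣p∣ {x = x} x∈p =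
  subst (_≤ _) (∣⁅x⁆∣≡1 x) (p⊆q⇒∣p∣≤∣q∣ λ y∈⁅x⁆ → subst (_∈ _) (sym (x∈⁅y⁆⇒x≡y x y∈⁅x⁆)) x∈p)

∣p∣≤1 : ∀ {r} (p : Subset r) → (∀ {x y} → x ∈ p → y ∈ p → x ≡ y) → ∣ p ∣ ≤ 1
∣p∣≤1 p unique with nonempty? p
... | yes (x , x∈p) = ≤-trans (p⊆q⇒∣p∣≤∣q∣ λ y∈p → subst (_∈ ⁅ x ⁆) (unique x∈p y∈p) (x∈⁅x⁆ x))
                              (≤-reflexive (∣⁅x⁆∣≡1 x))
... | no empty = ≤-trans (≤-reflexive (Empty⇒∣p∣≡0 empty)) z≤n

⊆-of-size : ∀ {r} (p : Subset r) {k} → k ≤ ∣ p ∣ → ∃ λ q → q ⊆ p × ∣ q ∣ ≡ k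
⊆-of-size [] z≤n = [] , (λ ()) , refl
⊆-of-size (false ∷ p) k≤∣p∣ with q , q⊆p , ∣q∣≡k ← ⊆-of-size p k≤∣p∣ = false ∷ q , out⊆ q⊆p , ∣q∣≡k
⊆-of-size {suc r} (true ∷ p) {zero} _ = ∅ , ⊥⊆ , ∣⊥∣≡0 (suc r)
⊆-of-size (true ∷ p) {suc k} (s≤s k≤∣p∣) with q , q⊆p , ∣q∣≡k ← ⊆-of-size p k≤∣p∣ =
  true ∷ q , in⊆in q⊆p , cong suc ∣q∣≡k

subsetOf : ∀ {r} {P : Pred (Fin r) 0ℓ} → Decidable P → Subset r
subsetOf P? = tabulate (does ∘ P?)

module _ {r} {P : Pred (Fin r) 0ℓ} (P? : Decidable P) where

  ∈-subsetOf⁺ : ∀ {t} → P t → t ∈ subsetOf P?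
  ∈-subsetOf⁺ {t} Pt = lookup⇒[]= t _ (trans (lookup∘tabulate _ t) (dec-true (P? t) Pt))

  ∈-subsetOf⁻ : ∀ {t} → t ∈ subsetOf P? → P t
  ∈-subsetOf⁻ {t} t∈P with P? t | trans (sym (lookup∘tabulate _ t)) ([]=⇒lookup t∈P)
  ... | yes Pt | _ = Pt
  ... | no _ | ()

fiber : ∀ {r} → Subset r → (Fin r → Bool) → Bool → Subset r
fiber p L b = p ∩ subsetOf (λ t → L t Boolₚ.≟ b)

module _ {r} {p : Subset r} (L : Fin r → Bool) {b : Bool} where

  ∈-fiber⁺ : ∀ {t} → t ∈ p → L t ≡ b → t ∈ fiber p L b
  ∈-fiber⁺ t∈p Lt≡b = x∈p∩q⁺ (t∈p , ∈-subsetOf⁺ (λ t → L t Boolₚ.≟ b) Lt≡b)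

  ∈-fiber⁻ : ∀ {t} → t ∈ fiber p L b → t ∈ p × L t ≡ b
  ∈-fiber⁻ t∈fiber with t∈p , t∈L⁻¹b ← x∈p∩q⁻ p _ t∈fiber = t∈p , ∈-subsetOf⁻ (λ t → L t Boolₚ.≟ b) t∈L⁻¹b

∣fiber∣+∣fiber∣≡∣p∣ : ∀ {r} (p : Subset r) (L : Fin r → Bool) → ∣ fiber p L true ∣ + ∣ fiber p L false ∣ ≡ ∣ p ∣
∣fiber∣+∣fiber∣≡∣p∣ [] L = refl
∣fiber∣+∣fiber∣≡∣p∣ (x ∷ p) L with x | L zero
... | true | true = cong suc (∣fiber∣+∣fiber∣≡∣p∣ p (L ∘ suc))
... | true | false = trans (+-suc _ _) (cong suc (∣fiber∣+∣fiber∣≡∣p∣ p (L ∘ suc)))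
... | false | _ = ∣fiber∣+∣fiber∣≡∣p∣ p (L ∘ suc)

Vec₀-unique : ∀ {A : Set} (u v : Vec A 0) → u ≡ v
Vec₀-unique [] [] = refl

head-tail-injective : ∀ {A : Set} {n} {u v : Vec A (suc n)} → head u ≡ head v → tail u ≡ tail v → u ≡ v
head-tail-injective {u = _ ∷ _} {_ ∷ _} = cong₂ _∷_

module HeadSplit {r n} (p : Subset r) (V : Fin r → Subset (suc n)) where

  part : Bool → Subset r
  part = fiber p (head ∘ V)

  ∣part∣+∣part∣≡∣p∣ : ∣ part true ∣ + ∣ part false ∣ ≡ ∣ p ∣
  ∣part∣+∣part∣≡∣p∣ = ∣fiber∣+∣fiber∣≡∣p∣ p (head ∘ V)

  tail-injective : (∀ {t t'} → t ∈ p → t' ∈ p → V t ≡ V t' → t ≡ t') →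
    ∀ b {t t'} → t ∈ part b → t' ∈ part b → tail (V t) ≡ tail (V t') → t ≡ t'
  tail-injective inj b t∈ t'∈ tails≡
    with t∈p , ht ← ∈-fiber⁻ (head ∘ V) t∈ | t'∈p , ht' ← ∈-fiber⁻ (head ∘ V) t'∈ =
    inj t∈p t'∈p (head-tail-injective (trans ht (sym ht')) tails≡)

  tail-≢∅ : (∀ {t} → t ∈ p → V t ≢ ∅) → ∀ {t} → t ∈ part false → tail (V t) ≢ ∅
  tail-≢∅ nonzero t∈ tail≡∅ with t∈p , ht ← ∈-fiber⁻ (head ∘ V) t∈ = nonzero t∈p (head-tail-injective ht tail≡∅)

  tail-covers : ∀ b w → (∃ λ t → t ∈ p × V t ≡ b ∷ w) → ∃ λ t → t ∈ part b × tail (V t) ≡ w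
  tail-covers b w (t , t∈p , Vt≡bw) = t , ∈-fiber⁺ (head ∘ V) t∈p (cong head Vt≡bw) , cong tail Vt≡bw

∣p∣≤2^n : ∀ {r} n (p : Subset r) (V : Fin r → Subset n) →
  (∀ {t t'} → t ∈ p → t' ∈ p → V t ≡ V t' → t ≡ t') → ∣ p ∣ ≤ 2 ^ n
∣p∣≤2^n zero p V inj = ∣p∣≤1 p λ t∈p t'∈p → inj t∈p t'∈p (Vec₀-unique _ _)
∣p∣≤2^n (suc n) p V inj = begin
  ∣ p ∣                          ≡⟨ ∣part∣+∣part∣≡∣p∣ ⟨
  ∣ part true ∣ + ∣ part false ∣  ≤⟨ +-mono-≤ (half true) (half false) ⟩
  2 ^ n + 2 ^ n                  ≡⟨ 2^suc n ⟨
  2 ^ suc n                      ∎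
  where
  open ≤-Reasoning
  open HeadSplit p V
  half : ∀ b → ∣ part b ∣ ≤ 2 ^ n
  half b = ∣p∣≤2^n n (part b) (tail ∘ V) (tail-injective inj b)

∣p∣<2^n : ∀ {r} n (p : Subset r) (V : Fin r → Subset n) →
  (∀ {t t'} → t ∈ p → t' ∈ p → V t ≡ V t' → t ≡ t') → (∀ {t} → t ∈ p → V t ≢ ∅) → ∣ p ∣ < 2 ^ n
∣p∣<2^n zero p V inj nonzero = s≤s (≤-reflexive (Empty⇒∣p∣≡0 λ (t , t∈p) → nonzero t∈p (Vec₀-unique _ _)))
∣p∣<2^n (suc n) p V inj nonzero = begin-strict
  ∣ p ∣                          ≡⟨ ∣part∣+∣part∣≡∣p∣ ⟨
  ∣ part true ∣ + ∣ part false ∣  <⟨ +-mono-≤-< (∣p∣≤2^n n (part true) (tail ∘ V) (tail-injective inj true))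
                                               (∣p∣<2^n n (part false) (tail ∘ V) (tail-injective inj false)
                                                        (tail-≢∅ nonzero)) ⟩
  2 ^ n + 2 ^ n                  ≡⟨ 2^suc n ⟨
  2 ^ suc n                      ∎
  where
  open ≤-Reasoning
  open HeadSplit p V

2^n≤∣p∣ : ∀ {r} n (p : Subset r) (V : Fin r → Subset n) →
  (∀ w → ∃ λ t → t ∈ p × V t ≡ w) → 2 ^ n ≤ ∣ p ∣
2^n≤∣p∣ zero p V covers with t , t∈p , _ ← covers [] = x∈p⇒1≤∣p∣ t∈p
2^n≤∣p∣ (suc n) p V covers = begin
  2 ^ suc n                      ≡⟨ 2^suc n ⟩
  2 ^ n + 2 ^ n                  ≤⟨ +-mono-≤ (half true) (half false) ⟩
  ∣ part true ∣ + ∣ part false ∣  ≡⟨ ∣part∣+∣part∣≡∣p∣ ⟩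
  ∣ p ∣                          ∎
  where
  open ≤-Reasoning
  open HeadSplit p V
  half : ∀ b → 2 ^ n ≤ ∣ part b ∣
  half b = 2^n≤∣p∣ n (part b) (tail ∘ V) λ w → tail-covers b w (covers (b ∷ w))

2^n≤1+∣p∣ : ∀ {r} n (p : Subset r) (V : Fin r → Subset n) →
  (∀ w → w ≢ ∅ → ∃ λ t → t ∈ p × V t ≡ w) → 2 ^ n ≤ suc ∣ p ∣
2^n≤1+∣p∣ zero p V covers = s≤s z≤n
2^n≤1+∣p∣ (suc n) p V covers = begin
  2 ^ suc n                            ≡⟨ 2^suc n ⟩
  2 ^ n + 2 ^ n                        ≤⟨ +-mono-≤ (2^n≤∣p∣ n (part true) (tail ∘ V) cover-true)
                                                   (2^n≤1+∣p∣ n (part false) (tail ∘ V) cover-false) ⟩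
  ∣ part true ∣ + suc ∣ part false ∣    ≡⟨ +-suc _ _ ⟩
  suc (∣ part true ∣ + ∣ part false ∣)  ≡⟨ cong suc ∣part∣+∣part∣≡∣p∣ ⟩
  suc ∣ p ∣                            ∎
  where
  open ≤-Reasoning
  open HeadSplit p V
  cover-true : ∀ w → ∃ λ t → t ∈ part true × tail (V t) ≡ w
  cover-true w = tail-covers true w (covers (true ∷ w) λ ())
  cover-false : ∀ w → w ≢ ∅ → ∃ λ t → t ∈ part false × tail (V t) ≡ w
  cover-false w w≢∅ = tail-covers false w (covers (false ∷ w) (w≢∅ ∘ ∷-injectiveʳ))

-- The lcm-filtration of the cut ideal

lcmOver-upper : ∀ {i r} (m : Fin r → Mon i) {σ : Subset r} {t} → t ∈ σ → m t ∣ₘ lcmOver m σ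
lcmOver-upper m here e = m≤m⊔n _ _
lcmOver-upper m (there t∈σ) e = ≤-trans (lcmOver-upper (m ∘ suc) t∈σ e) (m≤n⊔m _ _)

lcmOver-least : ∀ {i r} (m : Fin r → Mon i) (σ : Subset r) {u} → (∀ {t} → t ∈ σ → m t ∣ₘ u) → lcmOver m σ ∣ₘ u
lcmOver-least m [] _ e = z≤n
lcmOver-least m (true ∷ σ) bound e = ⊔-lub (bound here e) (lcmOver-least (m ∘ suc) σ (bound ∘ there) e)
lcmOver-least m (false ∷ σ) bound e = ⊔-lub z≤n (lcmOver-least (m ∘ suc) σ (bound ∘ there) e)

lcmIdeal-nonzero : ∀ {i r k} (m : Fin r → Mon i) → k ≤ r → NonzeroIdeal (lcmIdeal m k)
lcmIdeal-nonzero {r = r} m k≤r with σ , _ , ∣σ∣≡k ← ⊆-of-size ⊤ (subst (_ ≤_) (sym (∣⊤∣≡n r)) k≤r) =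
  lcmOver m σ , lcmOver m σ , (σ , ∣σ∣≡k , λ _ → refl) , ∣ₘ-refl

module CutEnumeration {i r : ℕ} (m : Fin r → Mon i)
  (m-gen : ∀ t → G (CutIdeal i) (m t)) (m-inj : ∀ t t' → m t ≈ₘ m t' → t ≡ t') where

  cut : Fin r → Fin i → Bool
  cut t = proj₁ (G-CutIdeal⁻ (m-gen t))

  cut-true : ∀ t → ∃ λ a → cut t a ≡ true
  cut-true t = proj₁ (proj₂ (G-CutIdeal⁻ (m-gen t)))

  cut-false : ∀ t → ∃ λ b → cut t b ≡ false
  cut-false t = proj₁ (proj₂ (proj₂ (G-CutIdeal⁻ (m-gen t))))

  m≈cutMon : ∀ t → m t ≈ₘ cutMon (cut t)
  m≈cutMon t = proj₂ (proj₂ (proj₂ (G-CutIdeal⁻ (m-gen t))))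

  SameCut⇒≡ : ∀ {t t'} → SameCut (cut t) (cut t') → t ≡ t'
  SameCut⇒≡ {t} {t'} same =
    m-inj t t' (≈ₘ-trans (m≈cutMon t) (≈ₘ-trans (SameCut⇒cutMon-≈ same) (≈ₘ-sym (m≈cutMon t'))))

  ∣σ∣<2^n : ∀ {n} {κ : Fin i → Fin (suc n)} → StrictlySurjective _≡_ κ →
    (σ : Subset r) → (∀ {t} → t ∈ σ → Refines κ (cut t)) → ∣ σ ∣ < 2 ^ n
  ∣σ∣<2^n {n} κ-onto σ κ⊑cut = ∣p∣<2^n n σ (crossing ∘ cut)
    (λ t∈σ t'∈σ eq → SameCut⇒≡ (crossing-injective (κ⊑cut t∈σ) (κ⊑cut t'∈σ) eq ,
                                crossing-injective (κ⊑cut t'∈σ) (κ⊑cut t∈σ) (sym eq)))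
    (λ {t} t∈σ → crossing-≢∅ (κ⊑cut t∈σ) (cut-true t) (cut-false t))
    where open Crossing κ-onto

  module _ (σ : Subset r) where

    Agree : Rel (Fin i) 0ℓ
    Agree x y = ∀ t → t ∈ σ → cut t x ≡ cut t y

    agree-isDecEquivalence : IsDecEquivalence Agree
    agree-isDecEquivalence = record
      { isEquivalence = record
        { refl = λ _ _ → refl
        ; sym = λ x∼y t t∈σ → sym (x∼y t t∈σ)
        ; trans = λ x∼y y∼z t t∈σ → trans (x∼y t t∈σ) (y∼z t t∈σ)
        }
      ; _≟_ = λ x y → all? λ t → (t ∈? σ) →-dec (cut t x Boolₚ.≟ cut t y)
      }

    separating-cut : ∀ {x y} → ¬ Agree x y → ∃ λ t → t ∈ σ × cut t x ≢ cut t y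
    separating-cut {x} {y} ¬agree
      with t , ¬agree-t ← ¬∀⟶∃¬ r _ (λ t → (t ∈? σ) →-dec (cut t x Boolₚ.≟ cut t y)) ¬agree
      with t ∈? σ
    ... | yes t∈σ = t , t∈σ , λ eq → ¬agree-t λ _ → eq
    ... | no t∉σ = ⊥-elim (¬agree-t λ t∈σ → ⊥-elim (t∉σ t∈σ))

    partitionMon-∣-lcmOver : ∀ {P} {κ : Fin i → Fin P} → (∀ x y → Agree x y → κ x ≡ κ y) →
      partitionMon κ ∣ₘ lcmOver m σ
    partitionMon-∣-lcmOver {κ = κ} agree⇒≡ (a , b , a<b) with κ a ≟ κ b
    ... | yes _ = z≤n
    ... | no κa≢κb with t , t∈σ , cut-a≢b ← separating-cut (κa≢κb ∘ agree⇒≡ a b) = begin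
      1                             ≡⟨ cutMon-≢ (cut t) a<b cut-a≢b ⟨
      cutMon (cut t) (a , b , a<b)  ≡⟨ m≈cutMon t (a , b , a<b) ⟨
      m t (a , b , a<b)             ≤⟨ lcmOver-upper m t∈σ (a , b , a<b) ⟩
      lcmOver m σ (a , b , a<b)     ∎
      where open ≤-Reasoning

  -- κ has Agree σ as its kernel, i.e. it is the common refinement of the cuts in σ. These cuts are
  -- distinct and coarser than κ, so κ has more than q + 1 blocks; coarsening κ to exactly q + 2
  -- blocks gives the divisor.
  lcmOver∈PartitionIdeal : ∀ q (σ : Subset r) → 2 ^ q ≤ ∣ σ ∣ → PartitionIdeal i (2 + q) (lcmOver m σ)
  lcmOver∈PartitionIdeal q σ 2^q≤∣σ∣ with kernel-surjection (agree-isDecEquivalence σ)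
  ... | zero , κ , _ with nonempty? σ
  ...   | yes (t , _) with () ← κ (proj₁ (cut-true t))
  ...   | no empty = ⊥-elim (<⇒≱ (m^n>0 2 q) (≤-trans 2^q≤∣σ∣ (≤-reflexive (Empty⇒∣p∣≡0 empty))))
  lcmOver∈PartitionIdeal q σ 2^q≤∣σ∣ | suc n , κ , κ-onto , agree⇒≡ , ≡⇒agree
    with ∣σ∣<2^n ← ∣σ∣<2^n κ-onto σ (λ t∈σ x y κx≡κy → ≡⇒agree x y κx≡κy _ t∈σ)
    with h , h-onto , κ⊑h ← coarsen (2^q<2^n⇒q<n (≤-<-trans 2^q≤∣σ∣ ∣σ∣<2^n)) κ-onto
    = partitionMon h , (h , h-onto , λ _ → refl) ,
      ∣ₘ-trans (refines⇒partitionMon-∣ κ⊑h) (partitionMon-∣-lcmOver σ agree⇒≡)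

  coarser? : ∀ {p} (f : Fin i → Fin p) t → Dec (Refines f (cut t))
  coarser? f t = refines? _≟_ Boolₚ._≟_ f (cut t)

  coarserCuts : ∀ {p} → (Fin i → Fin p) → Subset r
  coarserCuts f = subsetOf (coarser? f)

  module _ (m-onto : ∀ u → G (CutIdeal i) u → ∃ λ t → m t ≈ₘ u) where

    2^n≤1+∣coarserCuts∣ : ∀ {n} {κ : Fin i → Fin (suc n)} → StrictlySurjective _≡_ κ →
      2 ^ n ≤ suc ∣ coarserCuts κ ∣
    2^n≤1+∣coarserCuts∣ {n} {κ} κ-onto = 2^n≤1+∣p∣ n (coarserCuts κ) (crossing ∘ cut) covers
      where
      open Crossing κ-onto
      covers : ∀ w → w ≢ ∅ → ∃ λ t → t ∈ coarserCuts κ × crossing (cut t) ≡ w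
      covers w w≢∅
        with t , m≈c ← m-onto _ (G-CutIdeal⁺ (cutThrough w , cutThrough-true w≢∅ , cutThrough-false w , λ _ → refl)) =
        t , ∈-subsetOf⁺ (coarser? κ) κ⊑cut , trans (SameCut⇒crossing-≡ same) (crossing-cutThrough w)
        where
        same : SameCut (cut t) (cutThrough w)
        same = cutMon-≈⇒SameCut (≈ₘ-trans (≈ₘ-sym (m≈cutMon t)) m≈c)
        κ⊑cut : Refines κ (cut t)
        κ⊑cut x y κx≡κy = proj₂ same x y (κ⊑cutThrough w x y κx≡κy)

    k≤∣coarserCuts∣ : ∀ {q k} {f : Fin i → Fin (2 + q)} → StrictlySurjective _≡_ f → k < 2 ^ suc q →
      k ≤ ∣ coarserCuts f ∣
    k≤∣coarserCuts∣ {q} f-onto k<2^q+1 = ≤-pred (≤-trans k<2^q+1 (2^n≤1+∣coarserCuts∣ {n = suc q} f-onto))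

    lcmOver-∣-partitionMon : ∀ {q k} {f : Fin i → Fin (2 + q)} → StrictlySurjective _≡_ f → k < 2 ^ suc q →
      ∃ λ σ → ∣ σ ∣ ≡ k × lcmOver m σ ∣ₘ partitionMon f
    lcmOver-∣-partitionMon {q} {k} {f} f-onto k<2^q+1 =
      divides (⊆-of-size (coarserCuts f) (k≤∣coarserCuts∣ f-onto k<2^q+1))
      where
      divides : (∃ λ σ → σ ⊆ coarserCuts f × ∣ σ ∣ ≡ k) → ∃ λ σ → ∣ σ ∣ ≡ k × lcmOver m σ ∣ₘ partitionMon f
      divides (σ , σ⊆coarser , ∣σ∣≡k) = σ , ∣σ∣≡k , lcmOver-least m σ λ {t} t∈σ →
        ∣ₘ-trans (≈ₘ⇒∣ₘ (m≈cutMon t)) (refines⇒cutMon∣partitionMon (∈-subsetOf⁻ (coarser? f) (σ⊆coarser t∈σ)))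

    lcmIdeal≐PartitionIdeal : ∀ {q k} → 2 ^ q ≤ k → k < 2 ^ suc q → lcmIdeal m k ≐ PartitionIdeal i (2 + q)
    lcmIdeal≐PartitionIdeal {q} {k} 2^q≤k k<2^q+1 u = lcm⇒partition , partition⇒lcm
      where
      lcm⇒partition : lcmIdeal m k u → PartitionIdeal i (2 + q) u
      lcm⇒partition (v , (σ , ∣σ∣≡k , v≈lcm) , v∣u) =
        ⟨⟩-upward (lcmOver∈PartitionIdeal q σ (subst (2 ^ q ≤_) (sym ∣σ∣≡k) 2^q≤k))
                  (∣ₘ-trans (≈ₘ⇒∣ₘ (≈ₘ-sym v≈lcm)) v∣u)
      partition⇒lcm : PartitionIdeal i (2 + q) u → lcmIdeal m k u
      partition⇒lcm (v , (f , f-onto , v≈f) , v∣u) =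
        let σ , ∣σ∣≡k , lcm∣f = lcmOver-∣-partitionMon f-onto k<2^q+1 in
        lcmOver m σ , (σ , ∣σ∣≡k , λ _ → refl) , ∣ₘ-trans lcm∣f (∣ₘ-trans (≈ₘ⇒∣ₘ (≈ₘ-sym v≈f)) v∣u)

mainTheorem5 : (i : ℕ) → 2 ≤ i →
    (r : ℕ) (m : Fin r → Mon i) →
    (∀ t → G (CutIdeal i) (m t)) →
    (∀ u → G (CutIdeal i) u → ∃ λ t → m t ≈ₘ u) →
    (∀ t t' → m t ≈ₘ m t' → t ≡ t') →
    ((k : ℕ) → 1 ≤ k → k ≤ r →
       ∃ λ l → 1 ≤ l × NonzeroIdeal (stepwise (CutIdeal i) l)
         × (stepwise (CutIdeal i) l ≐ lcmIdeal m k))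
    × ((l : ℕ) → 1 ≤ l → NonzeroIdeal (stepwise (CutIdeal i) l) →
       ∃ λ k → 1 ≤ k × k ≤ r × (lcmIdeal m k ≐ stepwise (CutIdeal i) l))
mainTheorem5 i _ r m m-gen m-onto m-inj = lcm⇒stepwise , stepwise⇒lcm
  where
  open CutEnumeration m m-gen m-inj

  lcm⇒stepwise : ∀ k → 1 ≤ k → k ≤ r →
    ∃ λ l → 1 ≤ l × NonzeroIdeal (stepwise (CutIdeal i) l) × (stepwise (CutIdeal i) l ≐ lcmIdeal m k)
  lcm⇒stepwise k 1≤k k≤r =
    let q , 2^q≤k , k<2^q+1 = log₂-bracket 1≤k
        stepwise≐lcm = ≐-trans (stepwise-CutIdeal q) (≐-sym (lcmIdeal≐PartitionIdeal m-onto 2^q≤k k<2^q+1))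
    in suc q , s≤s z≤n , ≐-nonzero (≐-sym stepwise≐lcm) (lcmIdeal-nonzero m k≤r) , stepwise≐lcm

  stepwise⇒lcm : ∀ l → 1 ≤ l → NonzeroIdeal (stepwise (CutIdeal i) l) →
    ∃ λ k → 1 ≤ k × k ≤ r × (lcmIdeal m k ≐ stepwise (CutIdeal i) l)
  stepwise⇒lcm (suc q) _ nonzero =
    let _ , _ , (f , f-onto , _) , _ = ≐-nonzero (stepwise-CutIdeal q) nonzero
        σ , ∣σ∣≡2^q , _ = lcmOver-∣-partitionMon m-onto f-onto 2^q<2^q+1
    in 2 ^ q , m^n>0 2 q , subst (_≤ r) ∣σ∣≡2^q (∣p∣≤n σ) ,
       ≐-trans (lcmIdeal≐PartitionIdeal m-onto ≤-refl 2^q<2^q+1) (≐-sym (stepwise-CutIdeal q))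
    where
    2^q<2^q+1 : 2 ^ q < 2 ^ suc q
    2^q<2^q+1 = ^-monoʳ-< 2 (s≤s (s≤s z≤n)) (n<1+n q)
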